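{- Let $\Gamma$ be a finite group and $A$ a finite abelian group. Let $\Gamma'=A^{\#\Gamma}\rtimes\Gamma$ be the wreath product, with projection $\pi:\Gamma'\to\Gamma$, $(f,\sigma)\mapsto\sigma$. Let $S\subset\Gamma$ be a subset and put $S'=\pi^{ -1}(S)\subset\Gamma'$. Then there are at least $\left(1-\frac{\#\Gamma}{\#A}\right)\#S'$ elements $\xi=(f,\sigma)\in S'$ satisfying $$\pi(C_{\Gamma'}(\xi))\subset\langle\sigma\rangle,$$ where $C_{\Gamma'}(\xi)$ is the centralizer of $\xi$ in $\Gamma'$ and $\langle\sigma\rangle$ the cyclic subgroup of $\Gamma$ generated by $\sigma$.
   Context: Here $A^{\#\Gamma}$ is identified with the group $\mathrm{Map}(\Gamma,A)$ of functions $\Gamma\to A$ under pointwise addition, and $\Gamma$ acts on it by permuting coordinates via left translation, $(\sigma\cdot f)(x)=f(\sigma^{ -1}x)$; $\Gamma'$ is the corresponding semidirect product, whose elements are pairs $(f,\sigma)$. -}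

module Defs where

open import Data.Nat using (ℕ; zero; suc)
open import Data.Integer using (ℤ; +_; -[1+_])
open import Data.Fin using (Fin)
open import Data.Vec using (Vec; lookup; tabulate)
open import Data.Product using (_×_; _,_; proj₁; proj₂; ∃)
open import Relation.Binary.PropositionalEquality using (_≡_)
open import Algebra.Structures using (IsGroup; IsAbelianGroup)

-- A finite group, presented (up to isomorphism) on the carrier Fin n,
-- with propositional equality.  Its order is n.
record FinGroup (n : ℕ) : Set where
  field
    _∙_     : Fin n → Fin n → Fin n
    ε       : Fin n
    _⁻¹     : Fin n → Fin n
    isGroup : IsGroup _≡_ _∙_ ε _⁻¹

record FinAbGroup (m : ℕ) : Set where
  field
    _+_            : Fin m → Fin m → Fin m
    0#             : Fin m
    -_             : Fin m → Fin m
    isAbelianGroup : IsAbelianGroup _≡_ _+_ 0# -_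

-- Underlying set of the wreath product Γ' = A^{#Γ} ⋊ Γ :
-- pairs (f , σ) with f ∈ Map(Γ, A) (stored as a vector indexed by Γ = Fin n).
Wreath : ℕ → ℕ → Set
Wreath n m = Vec (Fin m) n × Fin n

module _ {n m : ℕ} (G : FinGroup n) (A : FinAbGroup m) where
  open FinGroup G
  open FinAbGroup A

  act : Fin n → Vec (Fin m) n → Vec (Fin m) n
  act σ f = tabulate (λ x → lookup f ((σ ⁻¹) ∙ x))

  addMap : Vec (Fin m) n → Vec (Fin m) n → Vec (Fin m) n
  addMap f g = tabulate (λ x → lookup f x + lookup g x)

  wmul : Wreath n m → Wreath n m → Wreath n m
  wmul (f , σ) (g , τ) = (addMap f (act σ g) , σ ∙ τ)

  π : Wreath n m → Fin n
  π = proj₂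

  powℕ : Fin n → ℕ → Fin n
  powℕ σ zero    = ε
  powℕ σ (suc k) = σ ∙ powℕ σ k

  powℤ : Fin n → ℤ → Fin n
  powℤ σ (+ k)      = powℕ σ k
  powℤ σ -[1+ k ]   = powℕ (σ ⁻¹) (suc k)

  InCyclic : Fin n → Fin n → Set
  InCyclic σ τ = ∃ λ (k : ℤ) → τ ≡ powℤ σ k

  CentralizerCond : Wreath n m → Set
  CentralizerCond ξ = (η : Wreath n m) → wmul η ξ ≡ wmul ξ η → InCyclic (π ξ) (π η)

-- For ξ = (f , σ) and a right coset C of ⟨σ⟩ write Σ_C f for the sum of f over C.  If (g , τ)
-- commutes with ξ then τ commutes with σ, and comparing first components gives
-- g(x) + f(τ⁻¹x) = f(x) + g(σ⁻¹x); summed over x ∈ ⟨σ⟩ the g-terms telescope, leaving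
-- Σ_{⟨σ⟩τ⁻¹} f = Σ_{⟨σ⟩} f.  Hence if Σ_{⟨σ⟩} f differs from the sum of f over every other right
-- coset ("f separates"), then τ⁻¹ and so τ lie in ⟨σ⟩.  Adding a to f(ε) adds a to Σ_{⟨σ⟩} f and
-- leaves the other coset sums alone, so once σ and f off ε are fixed, a collision with the coset
-- ⟨σ⟩y pins down f(ε); the non-separating elements of π⁻¹(S) are therefore among the images of the
-- #S · #A^(#Γ-1) · #Γ triples (σ , f|Γ∖ε , y).

module Submission where

open import Defs
open import Data.Nat using (ℕ; _*_; _+_; _^_; _≤_)
open import Data.Fin.Subset using (Subset; _∈_; ∣_∣)
open import Data.List using (List; length)
open import Data.List.Relation.Unary.All using (All)
open import Data.List.Relation.Unary.Unique.Propositional using (Unique)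
open import Data.Product using (_×_; ∃; proj₂)

open import Algebra.Bundles using (AbelianGroup; Group)
open import Algebra.Structures using (IsGroup; IsAbelianGroup)
import Data.Integer as ℤ
open import Data.Fin as Fin using (Fin; zero; suc; toℕ; inject₁; fromℕ; punchIn; punchOut)
open import Data.Fin.Properties
  using (all?; ¬∀⟶∃¬; ¬Fin0; toℕ<n; injective⇒≤; toℕ-inject₁; toℕ-fromℕ; punchIn-punchOut; pigeonhole)
open import Data.Fin.Subset using (inside; outside)
open import Data.Fin.Subset.Properties using (_∈?_)
open import Data.List as List using ([]; _∷_; filter; map; allFin; cartesianProductWith; cartesianProduct)
open import Data.List.Properties using (length-++; length-map; map-tabulate; length-tabulate)
open import Data.List.Membership.Propositional using () renaming (_∈_ to _∈ₗ_)
open import Data.List.Membership.Propositional.Properties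
  using (∈-lookup; ∈-filter⁻; ∈-allFin; ∈-map⁺; ∈-cartesianProductWith⁺; ∈-cartesianProduct⁺; ∈-cartesianProduct⁻)
import Data.List.Membership.Setoid.Properties as Membershipₛ
open import Data.List.Relation.Binary.Subset.Propositional using (_⊆_)
import Data.List.Relation.Unary.All as All
open import Data.List.Relation.Unary.AllPairs using ([]; _∷_)
open import Data.List.Relation.Unary.Any using (here)
import Data.List.Relation.Unary.Unique.Propositional.Properties as Unique
open import Data.Nat using (zero; suc; _∸_; _<_; s≤s)
open import Data.Nat.Induction using (<-wellFounded)
open import Data.Nat.Properties
  using (+-suc; +-monoʳ-≤; *-monoʳ-≤; module ≤-Reasoning; anyUpTo?; allUpTo?; n<1+n; m≤n⇒∃[o]m+o≡n)
open import Data.Nat.Solver using (module +-*-Solver)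
open import Data.Product using (_,_; proj₁)
open import Data.Vec as Vec using (Vec; insertAt; removeAt)
open import Data.Vec.Functional using (tail)
open import Data.Vec.Properties using (∷-injective; lookup∘tabulate; insertAt-punchIn; insertAt-lookup; insertAt-removeAt)
open import Function using (_∘_; id)
open import Induction.WellFounded using (Acc; acc)
open import Level using (0ℓ)
open import Relation.Binary.PropositionalEquality
  using (_≡_; _≢_; refl; sym; trans; cong; cong₂; subst; setoid; module ≡-Reasoning)
open import Relation.Nullary using (¬_; Dec; yes; no; ¬?; _→-dec_; decidable-stable; contradiction)
open import Relation.Unary using (Pred; Decidable)
open import Relation.Unary.Properties using (∁?)

module _ {X : Set} where

  Unique-lookup-injective : ∀ {xs : List X} → Unique xs →
                            ∀ {i j} → List.lookup xs i ≡ List.lookup xs j → i ≡ j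
  Unique-lookup-injective (x∉xs ∷ _) {zero}  {zero}  _ = refl
  Unique-lookup-injective (x∉xs ∷ _) {zero}  {suc j} e = contradiction e (All.lookup x∉xs (∈-lookup j))
  Unique-lookup-injective (x∉xs ∷ _) {suc i} {zero}  e = contradiction (sym e) (All.lookup x∉xs (∈-lookup i))
  Unique-lookup-injective (_ ∷ u)    {suc i} {suc j} e = cong suc (Unique-lookup-injective u e)

  Unique-⊆⇒length-≤ : ∀ {xs ys : List X} → Unique xs → xs ⊆ ys → length xs ≤ length ys
  Unique-⊆⇒length-≤ u xs⊆ys = injective⇒≤ λ {i} {j} e →
    Unique-lookup-injective u (Membershipₛ.index-injective (setoid X) (xs⊆ys (∈-lookup i)) (xs⊆ys (∈-lookup j)) e)

  module _ {P : Pred X 0ℓ} (P? : Decidable P) where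

    length-filter-+-filter-∁ : ∀ xs → length (filter P? xs) + length (filter (∁? P?) xs) ≡ length xs
    length-filter-+-filter-∁ []       = refl
    length-filter-+-filter-∁ (x ∷ xs) with P? x
    ... | yes _ = cong suc (length-filter-+-filter-∁ xs)
    ... | no  _ = trans (+-suc _ _) (cong suc (length-filter-+-filter-∁ xs))

    length-≤-filter+cover : ∀ {xs ys} → Unique xs → (∀ {x} → x ∈ₗ xs → ¬ P x → x ∈ₗ ys) →
                            length xs ≤ length (filter P? xs) + length ys
    length-≤-filter+cover {xs} {ys} u cover = subst (_≤ length (filter P? xs) + length ys)
      (length-filter-+-filter-∁ xs)
      (+-monoʳ-≤ (length (filter P? xs))
        (Unique-⊆⇒length-≤ (Unique.filter⁺ (∁? P?) u) λ x∈ →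
          let x∈xs , ¬Px = ∈-filter⁻ (∁? P?) x∈ in cover x∈xs ¬Px))

length-cartesianProductWith : ∀ {A B C : Set} (f : A → B → C) xs ys →
                              length (cartesianProductWith f xs ys) ≡ length xs * length ys
length-cartesianProductWith f []       ys = refl
length-cartesianProductWith f (x ∷ xs) ys = trans (length-++ (map (f x) ys))
  (cong₂ _+_ (length-map (f x) ys) (length-cartesianProductWith f xs ys))

length-filter-∈-tabulate-suc : ∀ {n} s (p : Subset n) →
  length (filter (_∈? (s Vec.∷ p)) (List.tabulate Fin.suc)) ≡ length (filter (_∈? p) (allFin n))
length-filter-∈-tabulate-suc s p =
  trans (cong (length ∘ filter (_∈? (s Vec.∷ p))) (sym (map-tabulate id Fin.suc)))
        (length-filter-map-suc-∈ (allFin _))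
  where
    length-filter-map-suc-∈ : ∀ xs →
      length (filter (_∈? (s Vec.∷ p)) (map Fin.suc xs)) ≡ length (filter (_∈? p) xs)
    length-filter-map-suc-∈ []       = refl
    length-filter-map-suc-∈ (x ∷ xs) with x ∈? p
    ... | yes _ = cong suc (length-filter-map-suc-∈ xs)
    ... | no  _ = length-filter-map-suc-∈ xs

length-filter-∈-allFin : ∀ {n} (p : Subset n) → length (filter (_∈? p) (allFin n)) ≡ ∣ p ∣
length-filter-∈-allFin Vec.[]            = refl
length-filter-∈-allFin (inside  Vec.∷ p) =
  cong suc (trans (length-filter-∈-tabulate-suc inside p) (length-filter-∈-allFin p))
length-filter-∈-allFin (outside Vec.∷ p) =
  trans (length-filter-∈-tabulate-suc outside p) (length-filter-∈-allFin p)

module _ (m : ℕ) where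

  allVecs : ∀ k → List (Vec (Fin m) k)
  allVecs zero    = Vec.[] ∷ []
  allVecs (suc k) = cartesianProductWith Vec._∷_ (allFin m) (allVecs k)

  length-allVecs : ∀ k → length (allVecs k) ≡ m ^ k
  length-allVecs zero    = refl
  length-allVecs (suc k) = trans (length-cartesianProductWith Vec._∷_ (allFin m) (allVecs k))
                                 (cong₂ _*_ (length-tabulate {n = m} id) (length-allVecs k))

  allVecs-Unique : ∀ k → Unique (allVecs k)
  allVecs-Unique zero    = All.[] ∷ []
  allVecs-Unique (suc k) =
    Unique.cartesianProductWith⁺ Vec._∷_ ∷-injective (Unique.allFin⁺ m) (allVecs-Unique k)

  ∈-allVecs : ∀ {k} (v : Vec (Fin m) k) → v ∈ₗ allVecs k
  ∈-allVecs Vec.[]       = here refl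
  ∈-allVecs (x Vec.∷ v) = ∈-cartesianProductWith⁺ Vec._∷_ (∈-allFin x) (∈-allVecs v)

lookup-insertAt-≢ : ∀ {X : Set} {k} (w : Vec X k) i (a b : X) {x} → i ≢ x →
                    Vec.lookup (insertAt w i a) x ≡ Vec.lookup (insertAt w i b) x
lookup-insertAt-≢ w i a b {x} i≢x = begin
  Vec.lookup (insertAt w i a) x    ≡⟨ cong (Vec.lookup (insertAt w i a)) (punchIn-punchOut i≢x) ⟨
  Vec.lookup (insertAt w i a) x′   ≡⟨ insertAt-punchIn w i a (punchOut i≢x) ⟩
  Vec.lookup w (punchOut i≢x)      ≡⟨ insertAt-punchIn w i b (punchOut i≢x) ⟨
  Vec.lookup (insertAt w i b) x′   ≡⟨ cong (Vec.lookup (insertAt w i b)) (punchIn-punchOut i≢x) ⟩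
  Vec.lookup (insertAt w i b) x    ∎
  where
    open ≡-Reasoning
    x′ = punchIn i (punchOut i≢x)

module _ {P : Pred ℕ 0ℓ} (P? : Decidable P) where

  least-witness : ∀ {v} → Acc _<_ v → P v → ∃ λ k → P k × (∀ {j} → j < k → ¬ P j)
  least-witness {v} (acc smaller) Pv with anyUpTo? P? v
  ... | yes (k , k<v , Pk) = least-witness (smaller k<v) Pk
  ... | no  ∄k<v          = v , Pv , λ j<v Pj → ∄k<v (_ , j<v , Pj)

module _ {c ℓ} (𝔸 : AbelianGroup c ℓ) where
  open AbelianGroup 𝔸 using (Carrier; _≈_; commutativeMonoid; group; comm; ∙-congˡ)
    renaming (_∙_ to _⊕_; setoid to 𝔸-setoid)
  open import Algebra.Properties.CommutativeMonoid.Sum commutativeMonoid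
    using (sum-syntax; ∑-distrib-+; sum-cong-≗; sum-cong-≋; sum-init-last)
  open import Algebra.Properties.Group group using (∙-cancelˡ)
  open import Relation.Binary.Reasoning.Setoid 𝔸-setoid

  ∑-rotate : ∀ D (h : ℕ → Carrier) → h D ≈ h 0 → ∑[ k < D ] h (suc (toℕ k)) ≈ ∑[ k < D ] h (toℕ k)
  ∑-rotate zero    h _        = AbelianGroup.refl 𝔸
  ∑-rotate (suc D) h periodic = begin
    ∑[ k < suc D ] h (suc (toℕ k))                 ≈⟨ sum-init-last (λ k → h (suc (toℕ k))) ⟩
    ∑[ k < D ] h (suc (toℕ (inject₁ k))) ⊕ h (suc (toℕ (fromℕ D)))
      ≡⟨ cong₂ _⊕_ (sum-cong-≗ {D} λ k → cong (h ∘ suc) (toℕ-inject₁ k)) (cong (h ∘ suc) (toℕ-fromℕ D)) ⟩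
    ∑[ k < D ] h (suc (toℕ k)) ⊕ h (suc D)          ≈⟨ ∙-congˡ periodic ⟩
    ∑[ k < D ] h (suc (toℕ k)) ⊕ h 0                ≈⟨ comm _ _ ⟩
    ∑[ k < suc D ] h (toℕ k)                        ∎

  ∑-telescope : ∀ D (h u v : ℕ → Carrier) → h D ≈ h 0 → (∀ k → h k ⊕ u k ≈ v k ⊕ h (suc k)) →
                ∑[ k < D ] u (toℕ k) ≈ ∑[ k < D ] v (toℕ k)
  ∑-telescope D h u v periodic step = ∙-cancelˡ (∑[ k < D ] h (toℕ k)) _ _ (begin
    ∑[ k < D ] h (toℕ k) ⊕ ∑[ k < D ] u (toℕ k)        ≈⟨ ∑-distrib-+ {D} (h ∘ toℕ) (u ∘ toℕ) ⟨
    ∑[ k < D ] (h (toℕ k) ⊕ u (toℕ k))                ≈⟨ sum-cong-≋ {D} (step ∘ toℕ) ⟩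
    ∑[ k < D ] (v (toℕ k) ⊕ h (suc (toℕ k)))          ≈⟨ ∑-distrib-+ {D} (v ∘ toℕ) (h ∘ suc ∘ toℕ) ⟩
    ∑[ k < D ] v (toℕ k) ⊕ ∑[ k < D ] h (suc (toℕ k))  ≈⟨ ∙-congˡ (∑-rotate D h periodic) ⟩
    ∑[ k < D ] v (toℕ k) ⊕ ∑[ k < D ] h (toℕ k)        ≈⟨ comm _ _ ⟩
    ∑[ k < D ] h (toℕ k) ⊕ ∑[ k < D ] v (toℕ k)        ∎)

module Centralizers {n m : ℕ} (G : FinGroup n) (A : FinAbGroup m) where
  open FinGroup G
  open IsGroup isGroup using (assoc; identityˡ; identityʳ)
  private
    𝔾 : Group 0ℓ 0ℓ
    𝔾 = record { isGroup = isGroup }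

    pow : Fin n → ℕ → Fin n
    pow = powℕ G A

  powℕ-+ : ∀ ρ i j → pow ρ (i + j) ≡ pow ρ i ∙ pow ρ j
  powℕ-+ ρ zero    j = sym (identityˡ _)
  powℕ-+ ρ (suc i) j = trans (cong (ρ ∙_) (powℕ-+ ρ i j)) (sym (assoc _ _ _))

  powℕ-commute : ∀ {ρ τ} → τ ∙ ρ ≡ ρ ∙ τ → ∀ k → τ ∙ pow ρ k ≡ pow ρ k ∙ τ
  powℕ-commute         τρ≡ρτ zero    = trans (identityʳ _) (sym (identityˡ _))
  powℕ-commute {ρ} {τ} τρ≡ρτ (suc k) = begin
    τ ∙ (ρ ∙ pow ρ k)   ≡⟨ assoc _ _ _ ⟨
    (τ ∙ ρ) ∙ pow ρ k   ≡⟨ cong (_∙ pow ρ k) τρ≡ρτ ⟩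
    (ρ ∙ τ) ∙ pow ρ k   ≡⟨ assoc _ _ _ ⟩
    ρ ∙ (τ ∙ pow ρ k)   ≡⟨ cong (ρ ∙_) (powℕ-commute τρ≡ρτ k) ⟩
    ρ ∙ (pow ρ k ∙ τ)   ≡⟨ assoc _ _ _ ⟨
    (ρ ∙ pow ρ k) ∙ τ   ∎
    where open ≡-Reasoning

  finite-order : ∀ ρ → ∃ λ k → pow ρ (suc k) ≡ ε
  finite-order ρ with i , j , i<j , ρⁱ≡ρʲ ← pigeonhole (n<1+n n) (λ (i : Fin (suc n)) → pow ρ (toℕ i)) =
    let k , i+1+k≡j = m≤n⇒∃[o]m+o≡n i<j in
    k , ∙-cancelˡ (pow ρ (toℕ i)) _ _ (begin
      pow ρ (toℕ i) ∙ pow ρ (suc k)   ≡⟨ powℕ-+ ρ (toℕ i) (suc k) ⟨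
      pow ρ (toℕ i + suc k)           ≡⟨ cong (pow ρ) (trans (+-suc _ k) i+1+k≡j) ⟩
      pow ρ (toℕ j)                   ≡⟨ ρⁱ≡ρʲ ⟨
      pow ρ (toℕ i)                   ≡⟨ identityʳ _ ⟨
      pow ρ (toℕ i) ∙ ε               ∎)
    where
      open ≡-Reasoning
      open import Algebra.Properties.Group 𝔾 using (∙-cancelˡ)

  -- Opaque, so that unification never unfolds the pigeonhole search behind `order`.
  private opaque
    minimalPeriod : ∀ ρ → ∃ λ k → pow ρ (suc k) ≡ ε × (∀ {j} → j < k → pow ρ (suc j) ≢ ε)
    minimalPeriod ρ = let v , ρᵛ⁺¹≡ε = finite-order ρ in
      least-witness (λ k → pow ρ (suc k) Fin.≟ ε) (<-wellFounded v) ρᵛ⁺¹≡ε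

  order : Fin n → ℕ
  order ρ = suc (proj₁ (minimalPeriod ρ))

  pow-order : ∀ ρ → pow ρ (order ρ) ≡ ε
  pow-order ρ = proj₁ (proj₂ (minimalPeriod ρ))

  pow-suc-≢ε : ∀ ρ {k} → suc k < order ρ → pow ρ (suc k) ≢ ε
  pow-suc-≢ε ρ (s≤s k<) = proj₂ (proj₂ (minimalPeriod ρ)) k<

  InCyclic-powℕ-⁻¹ : ∀ σ k → InCyclic G A σ (pow (σ ⁻¹) k)
  InCyclic-powℕ-⁻¹ σ zero    = ℤ.+ 0 , refl
  InCyclic-powℕ-⁻¹ σ (suc k) = ℤ.-[1+ k ] , refl

  open FinAbGroup A using (isAbelianGroup) renaming (_+_ to _⊕_)
  private
    𝔸 : AbelianGroup 0ℓ 0ℓ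
    𝔸 = record { isAbelianGroup = isAbelianGroup }
  open import Algebra.Properties.CommutativeMonoid.Sum (AbelianGroup.commutativeMonoid 𝔸)
    using (sum-syntax; sum-cong-≗)

  -- The sum of f over the right coset ⟨ρ⟩y, each element counted once as `order ρ` is minimal.
  cosetSum : Fin n → Vec (Fin m) n → Fin n → Fin m
  cosetSum ρ f y = ∑[ k < order ρ ] Vec.lookup f (pow ρ (toℕ k) ∙ y)

  _∉⟨_⟩ : Fin n → Fin n → Set
  y ∉⟨ ρ ⟩ = ∀ {k} → k < order ρ → pow ρ k ∙ y ≢ ε

  Separating : Fin n → Vec (Fin m) n → Set
  Separating σ f = ∀ y → y ∉⟨ σ ⁻¹ ⟩ → cosetSum (σ ⁻¹) f y ≢ cosetSum (σ ⁻¹) f ε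

  lookup-wmul : ∀ f σ g τ x →
    Vec.lookup (proj₁ (wmul G A (f , σ) (g , τ))) x ≡ Vec.lookup f x ⊕ Vec.lookup g ((σ ⁻¹) ∙ x)
  lookup-wmul f σ g τ x = trans (lookup∘tabulate _ x) (cong (Vec.lookup f x ⊕_) (lookup∘tabulate _ x))

  module _ {f σ g τ} (commute : wmul G A (g , τ) (f , σ) ≡ wmul G A (f , σ) (g , τ)) where
    private
      ρ = σ ⁻¹

    τ⁻¹-commutes-with-σ⁻¹ : (τ ⁻¹) ∙ ρ ≡ ρ ∙ (τ ⁻¹)
    τ⁻¹-commutes-with-σ⁻¹ = begin
      (τ ⁻¹) ∙ (σ ⁻¹)   ≡⟨ ⁻¹-anti-homo-∙ σ τ ⟨
      (σ ∙ τ) ⁻¹    ≡⟨ cong (_⁻¹ ∘ proj₂) commute ⟨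
      (τ ∙ σ) ⁻¹    ≡⟨ ⁻¹-anti-homo-∙ τ σ ⟩
      (σ ⁻¹) ∙ (τ ⁻¹)   ∎
      where
        open ≡-Reasoning
        open import Algebra.Properties.Group 𝔾 using (⁻¹-anti-homo-∙)

    cosetSum-τ⁻¹≡cosetSum-ε : cosetSum ρ f (τ ⁻¹) ≡ cosetSum ρ f ε
    cosetSum-τ⁻¹≡cosetSum-ε = begin
      ∑[ k < order ρ ] f⟨ pow ρ (toℕ k) ∙ (τ ⁻¹) ⟩
        ≡⟨ sum-cong-≗ {order ρ} (λ k → cong f⟨_⟩ (powℕ-commute τ⁻¹-commutes-with-σ⁻¹ (toℕ k))) ⟨
      ∑[ k < order ρ ] f⟨ (τ ⁻¹) ∙ pow ρ (toℕ k) ⟩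
        ≡⟨ ∑-telescope 𝔸 (order ρ) (λ k → g⟨ pow ρ k ⟩) (λ k → f⟨ (τ ⁻¹) ∙ pow ρ k ⟩) (λ k → f⟨ pow ρ k ⟩)
                       (cong g⟨_⟩ (pow-order ρ)) (λ k → twisted (pow ρ k)) ⟩
      ∑[ k < order ρ ] f⟨ pow ρ (toℕ k) ⟩
        ≡⟨ sum-cong-≗ {order ρ} (λ k → cong f⟨_⟩ (identityʳ (pow ρ (toℕ k)))) ⟨
      ∑[ k < order ρ ] f⟨ pow ρ (toℕ k) ∙ ε ⟩
        ∎
      where
        open ≡-Reasoning
        f⟨_⟩ g⟨_⟩ : Fin n → Fin m
        f⟨ x ⟩ = Vec.lookup f x
        g⟨ x ⟩ = Vec.lookup g x
        twisted : ∀ x → g⟨ x ⟩ ⊕ f⟨ (τ ⁻¹) ∙ x ⟩ ≡ f⟨ x ⟩ ⊕ g⟨ (σ ⁻¹) ∙ x ⟩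
        twisted x = trans (sym (lookup-wmul g τ f σ x))
                          (trans (cong (λ ξ → Vec.lookup (proj₁ ξ) x) commute) (lookup-wmul f σ g τ x))

  separating⇒centralizerCond : ∀ {σ f} → Separating σ f → CentralizerCond G A (f , σ)
  separating⇒centralizerCond {σ} {f} sep (g , τ) commute
    with anyUpTo? (λ k → pow (σ ⁻¹) k ∙ (τ ⁻¹) Fin.≟ ε) (order (σ ⁻¹))
  ... | yes (k , _ , ρᵏτ⁻¹≡ε) =
    subst (InCyclic G A σ) (x∙y⁻¹≈ε⇒x≈y _ _ ρᵏτ⁻¹≡ε) (InCyclic-powℕ-⁻¹ σ k)
    where open import Algebra.Properties.Group 𝔾 using (x∙y⁻¹≈ε⇒x≈y)
  ... | no  τ⁻¹∉⟨σ⁻¹⟩ =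
    contradiction (cosetSum-τ⁻¹≡cosetSum-ε {f} {σ} {g} {τ} commute)
                  (sep (τ ⁻¹) λ k< ρᵏτ⁻¹≡ε → τ⁻¹∉⟨σ⁻¹⟩ (_ , k< , ρᵏτ⁻¹≡ε))

  _∉⟨_⟩? : ∀ y ρ → Dec (y ∉⟨ ρ ⟩)
  y ∉⟨ ρ ⟩? = allUpTo? (λ k → ¬? (pow ρ k ∙ y Fin.≟ ε)) (order ρ)

  separatesAt? : ∀ σ f y → Dec (y ∉⟨ σ ⁻¹ ⟩ → cosetSum (σ ⁻¹) f y ≢ cosetSum (σ ⁻¹) f ε)
  separatesAt? σ f y = y ∉⟨ σ ⁻¹ ⟩? →-dec ¬? (cosetSum (σ ⁻¹) f y Fin.≟ cosetSum (σ ⁻¹) f ε)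

  separating? : ∀ σ f → Dec (Separating σ f)
  separating? σ f = all? (separatesAt? σ f)

module Counting {n m : ℕ} (G : FinGroup (suc n)) (A : FinAbGroup m) where
  open Centralizers G A
  open FinGroup G using (ε; _∙_; _⁻¹; isGroup)
  open IsGroup isGroup using (identityˡ)
  open FinAbGroup A using (0#; -_; isAbelianGroup) renaming (_+_ to _⊕_)
  open IsAbelianGroup isAbelianGroup using () renaming (identityˡ to ⊕-identityˡ)
  private
    𝔸 : AbelianGroup 0ℓ 0ℓ
    𝔸 = record { isAbelianGroup = isAbelianGroup }

  module _ (ρ : Fin (suc n)) (w : Vec (Fin m) n) where
    open import Algebra.Properties.CommutativeMonoid.Sum (AbelianGroup.commutativeMonoid 𝔸)
      using (sum; sum-cong-≗)

    cosetSum-insertAt-∉ : ∀ a b {y} → y ∉⟨ ρ ⟩ →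
                          cosetSum ρ (insertAt w ε a) y ≡ cosetSum ρ (insertAt w ε b) y
    cosetSum-insertAt-∉ a b y∉⟨ρ⟩ = sum-cong-≗ {order ρ} λ k →
      lookup-insertAt-≢ w ε a b (y∉⟨ρ⟩ (toℕ<n k) ∘ sym)

    -- Only the k = 0 term of the sum over ⟨ρ⟩ = ⟨ρ⟩ε looks at position ε.
    cosetSum-insertAt-ε : ∀ a → cosetSum ρ (insertAt w ε a) ε ≡ a ⊕ cosetSum ρ (insertAt w ε 0#) ε
    cosetSum-insertAt-ε a = begin
      f⟨ a ⟩ (ε ∙ ε) ⊕ rest a     ≡⟨ cong₂ _⊕_ (value-at-ε a) rest-independent ⟩
      a ⊕ rest 0#                 ≡⟨ cong (a ⊕_) (⊕-identityˡ _) ⟨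
      a ⊕ (0# ⊕ rest 0#)          ≡⟨ cong (λ z → a ⊕ (z ⊕ rest 0#)) (value-at-ε 0#) ⟨
      a ⊕ (f⟨ 0# ⟩ (ε ∙ ε) ⊕ rest 0#) ∎
      where
        open ≡-Reasoning
        f⟨_⟩ : Fin m → Fin (suc n) → Fin m
        f⟨ a ⟩ = Vec.lookup (insertAt w ε a)
        rest : Fin m → Fin m
        rest a = sum (tail {n = order ρ ∸ 1} λ k → f⟨ a ⟩ (powℕ G A ρ (toℕ k) ∙ ε))
        value-at-ε : ∀ a → f⟨ a ⟩ (ε ∙ ε) ≡ a
        value-at-ε a = trans (cong f⟨ a ⟩ (identityˡ ε)) (insertAt-lookup w ε a)
        rest-independent : rest a ≡ rest 0#
        rest-independent = sum-cong-≗ λ k → lookup-insertAt-≢ w ε a 0# λ ε≡ρᵏ⁺¹ε →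
          pow-suc-≢ε ρ (s≤s (toℕ<n k)) (trans (sym (IsGroup.identityʳ isGroup _)) (sym ε≡ρᵏ⁺¹ε))

  -- The one value of f(ε) for which f = insertAt w ε _ has equal sums over ⟨σ⟩ and ⟨σ⟩y.
  collisionValue : Fin (suc n) → Vec (Fin m) n → Fin (suc n) → Fin m
  collisionValue σ w y = cosetSum (σ ⁻¹) f₀ y ⊕ (- cosetSum (σ ⁻¹) f₀ ε)
    where f₀ = insertAt w ε 0#

  ¬separating⇒collision : ∀ {σ f} → ¬ Separating σ f →
    ∃ λ y → y ∉⟨ σ ⁻¹ ⟩ × cosetSum (σ ⁻¹) f y ≡ cosetSum (σ ⁻¹) f ε
  ¬separating⇒collision {σ} {f} ¬sep
    with y , ¬separatesAt-y ← ¬∀⟶∃¬ _ _ (separatesAt? σ f) ¬sep =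
    y , decidable-stable (y ∉⟨ σ ⁻¹ ⟩?) (λ y∈ → ¬separatesAt-y λ y∉ → contradiction (λ {k} → y∉ {k}) y∈)
      , decidable-stable (cosetSum (σ ⁻¹) f y Fin.≟ _) (λ ≢ → ¬separatesAt-y λ _ → ≢)

  ¬separating-insertAt⇒collisionValue : ∀ {σ w a} → ¬ Separating σ (insertAt w ε a) →
                                        ∃ λ y → a ≡ collisionValue σ w y
  ¬separating-insertAt⇒collisionValue {σ} {w} {a} ¬sep
    with y , y∉ , collide ← ¬separating⇒collision {σ} {insertAt w ε a} ¬sep =
    y , (begin
      a                                   ≡⟨ //-rightDividesʳ (cosetSum ρ f₀ ε) a ⟨
      (a ⊕ cosetSum ρ f₀ ε) ⊕ (- cosetSum ρ f₀ ε)  ≡⟨ cong (_⊕ (- cosetSum ρ f₀ ε)) shifted ⟩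
      collisionValue σ w y                ∎)
    where
      open ≡-Reasoning
      open import Algebra.Properties.Group (AbelianGroup.group 𝔸) using (//-rightDividesʳ)
      ρ = σ ⁻¹
      f₀ = insertAt w ε 0#
      shifted : a ⊕ cosetSum ρ f₀ ε ≡ cosetSum ρ f₀ y
      shifted = trans (sym (cosetSum-insertAt-ε ρ w a)) (trans (sym collide) (cosetSum-insertAt-∉ ρ w a 0# y∉))

  elementsOf : Subset (suc n) → List (Fin (suc n))
  elementsOf S = filter (_∈? S) (allFin (suc n))

  preimage : Subset (suc n) → List (Wreath (suc n) m)
  preimage S = cartesianProduct (allVecs m (suc n)) (elementsOf S)

  exceptional : Fin (suc n) × Vec (Fin m) n × Fin (suc n) → Wreath (suc n) m
  exceptional (σ , w , y) = insertAt w ε (collisionValue σ w y) , σ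

  exceptionIndices : Subset (suc n) → List (Fin (suc n) × Vec (Fin m) n × Fin (suc n))
  exceptionIndices S = cartesianProduct (elementsOf S) (cartesianProduct (allVecs m n) (allFin (suc n)))

  exceptions : Subset (suc n) → List (Wreath (suc n) m)
  exceptions S = map exceptional (exceptionIndices S)

  SeparatingElement : Wreath (suc n) m → Set
  SeparatingElement (f , σ) = Separating σ f

  ¬separating⇒∈exceptions : ∀ {S ξ} → ξ ∈ₗ preimage S → ¬ SeparatingElement ξ → ξ ∈ₗ exceptions S
  ¬separating⇒∈exceptions {S} {f , σ} ξ∈ ¬sep
    with _ , σ∈S ← ∈-cartesianProduct⁻ (allVecs m (suc n)) (elementsOf S) ξ∈
    with y , a≡ ← ¬separating-insertAt⇒collisionValue (subst (¬_ ∘ Separating σ) (sym (insertAt-removeAt f ε)) ¬sep) =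
    subst (_∈ₗ exceptions S) exceptional≡ξ (∈-map⁺ exceptional {xs = exceptionIndices S}
      (∈-cartesianProduct⁺ σ∈S (∈-cartesianProduct⁺ (∈-allVecs m (removeAt f ε)) (∈-allFin y))))
    where
      exceptional≡ξ : exceptional (σ , removeAt f ε , y) ≡ (f , σ)
      exceptional≡ξ = cong (_, σ) (trans (cong (insertAt (removeAt f ε) ε) (sym a≡)) (insertAt-removeAt f ε))

  length-preimage : ∀ S → length (preimage S) ≡ m ^ suc n * ∣ S ∣
  length-preimage S = trans (length-cartesianProductWith _,_ (allVecs m (suc n)) (elementsOf S))
                            (cong₂ _*_ (length-allVecs m (suc n)) (length-filter-∈-allFin S))

  length-exceptions : ∀ S → length (exceptions S) ≡ ∣ S ∣ * (m ^ n * suc n)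
  length-exceptions S = begin
    length (map exceptional (exceptionIndices S))
      ≡⟨ length-map exceptional (exceptionIndices S) ⟩
    length (exceptionIndices S)
      ≡⟨ length-cartesianProductWith _,_ (elementsOf S) _ ⟩
    length (elementsOf S) * length (cartesianProduct (allVecs m n) (allFin (suc n)))
      ≡⟨ cong (length (elementsOf S) *_) (length-cartesianProductWith _,_ (allVecs m n) (allFin (suc n))) ⟩
    length (elementsOf S) * (length (allVecs m n) * length (allFin (suc n)))
      ≡⟨ cong₂ _*_ (length-filter-∈-allFin S) (cong₂ _*_ (length-allVecs m n) (length-tabulate id)) ⟩
    ∣ S ∣ * (m ^ n * suc n)                                                  ∎
    where open ≡-Reasoning

  preimage-Unique : ∀ S → Unique (preimage S)
  preimage-Unique S =
    Unique.cartesianProduct⁺ (allVecs-Unique m (suc n)) (Unique.filter⁺ (_∈? S) (Unique.allFin⁺ (suc n)))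

  ∈-preimage⁻ : ∀ {S ξ} → ξ ∈ₗ preimage S → proj₂ ξ ∈ S
  ∈-preimage⁻ {S} ξ∈ = proj₂ (∈-filter⁻ (_∈? S) {xs = allFin (suc n)}
    (proj₂ (∈-cartesianProduct⁻ (allVecs m (suc n)) (elementsOf S) ξ∈)))

  separatingElement? : Decidable SeparatingElement
  separatingElement? (f , σ) = separating? σ f

  length-preimage-≤ : ∀ S →
    length (preimage S) ≤ length (filter separatingElement? (preimage S)) + length (exceptions S)
  length-preimage-≤ S =
    length-≤-filter+cover separatingElement? {ys = exceptions S} (preimage-Unique S) (¬separating⇒∈exceptions {S})

lemma7p5 : {n m : ℕ} (G : FinGroup n) (A : FinAbGroup m) (S : Subset n) →
    ∃ λ (L : List (Wreath n m)) →
      Unique L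
      × All (λ ξ → (proj₂ ξ ∈ S) × CentralizerCond G A ξ) L
      × m * (m ^ n * ∣ S ∣) ≤ length L * m + n * (m ^ n * ∣ S ∣)
lemma7p5 {zero}      G A S = contradiction (FinGroup.ε G) ¬Fin0
lemma7p5 {suc n} {m} G A S = L , Unique.filter⁺ separatingElement? (preimage-Unique S) , properties , bound
  where
    open Counting G A
    L = filter separatingElement? (preimage S)

    properties : All (λ ξ → (proj₂ ξ ∈ S) × CentralizerCond G A ξ) L
    properties = All.tabulate λ {(f , σ)} ξ∈L → let ξ∈S′ , sep = ∈-filter⁻ separatingElement? ξ∈L in
      ∈-preimage⁻ ξ∈S′ , Centralizers.separating⇒centralizerCond G A {σ} {f} sep

    bound : m * (m ^ suc n * ∣ S ∣) ≤ length L * m + suc n * (m ^ suc n * ∣ S ∣)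
    bound = begin
      m * (m ^ suc n * ∣ S ∣)                          ≡⟨ cong (m *_) (length-preimage S) ⟨
      m * length (preimage S)                          ≤⟨ *-monoʳ-≤ m (length-preimage-≤ S) ⟩
      m * (length L + length (exceptions S))           ≡⟨ cong (λ e → m * (length L + e)) (length-exceptions S) ⟩
      m * (length L + ∣ S ∣ * (m ^ n * suc n))         ≡⟨ solve 5 (λ m l s p N → m :* (l :+ s :* (p :* N)) := l :* m :+ N :* ((m :* p) :* s))
                                                                refl m (length L) ∣ S ∣ (m ^ n) (suc n) ⟩
      length L * m + suc n * (m ^ suc n * ∣ S ∣)       ∎
      where
        open ≤-Reasoning
        open +-*-Solver
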